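{- Let $e\geq 3$ be an integer and let $J(2e+1,e)$ be the Johnson graph. Then $\mu(J(2e+1,e))\leq 2e$.
   Context: For a connected graph $\Gamma$ with distance function $d$, a resolving set is a set of vertices $S=\{v_1,\ldots,v_k\}$ such that for any two distinct vertices $u,v$ the vectors $(d(u,v_1),\ldots,d(u,v_k))$ and $(d(v,v_1),\ldots,d(v,v_k))$ differ. The metric dimension $\mu(\Gamma)$ is the smallest size of a resolving set of $\Gamma$. For integers $2\le 2e\le n$, the Johnson graph $J(n,e)$ has as vertices the $e$-element subsets of $\{1,\ldots,n\}$, two vertices $P,Q$ being adjacent iff $|P\cap Q|=e-1$. -}

module Defs where

open import Level using (Level; _⊔_) renaming (suc to lsuc)
open import Data.Nat using (ℕ; zero; suc; _<_; _≤_; _∸_; _+_)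
open import Data.Product using (Σ; _×_; proj₁; ∃-syntax)
open import Data.List using (List; length)
open import Data.List.Membership.Propositional using (_∈_)
open import Data.Fin.Subset using (Subset; ∣_∣; _∩_)
open import Relation.Nullary using (¬_)
open import Relation.Binary.PropositionalEquality using (_≡_)
open import Function.Bundles using (_⇔_)

module _ {a r : Level} {V : Set a} (Adj : V → V → Set r) where

  data Walk : V → V → ℕ → Set (a ⊔ r) where
    here : ∀ {u} → Walk u u zero
    step : ∀ {u w v k} → Adj u w → Walk w v k → Walk u v (suc k)

  Dist : V → V → ℕ → Set (a ⊔ r)
  Dist u v k = Walk u v k × (∀ j → j < k → ¬ Walk u v j)

  Resolving : {ℓ : Level} → (V → V → Set ℓ) → List V → Set (a ⊔ r ⊔ ℓ)
  Resolving _≈_ S = ∀ u v → (∀ s → s ∈ S → ∀ k → Dist u s k ⇔ Dist v s k) → u ≈ v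

  MetricDimension≤ : {ℓ : Level} → (V → V → Set ℓ) → ℕ → Set (a ⊔ r ⊔ ℓ)
  MetricDimension≤ _≈_ m = ∃[ S ] (length S ≤ m × Resolving _≈_ S)

JVertex : ℕ → ℕ → Set
JVertex n e = Σ (Subset n) (λ P → ∣ P ∣ ≡ e)

JAdj : (n e : ℕ) → JVertex n e → JVertex n e → Set
JAdj n e P Q = ∣ proj₁ P ∩ proj₁ Q ∣ ≡ e ∸ 1

_≈J_ : {n e : ℕ} → JVertex n e → JVertex n e → Set
P ≈J Q = proj₁ P ≡ proj₁ Q

module Submission where

-- In the Johnson graph J(n, e) the distance between vertices P and S is
-- e − |P ∩ S|: an edge changes the overlap with S by at most one, and exchanging
-- a point of P ∖ S for one of S ∖ P raises it by exactly one.  Hence a list of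
-- vertices is resolving as soon as the overlaps with its members separate
-- vertices (Johnson.resolving-via-overlaps).
--
-- For e = m + 2 split the 2e + 1 points into blocks X, A, B, C of sizes
-- 1, m + 1, e, 1 and take the 2e landmarks X ∪ A, A ∪ C, A ∪ {b} (b ∈ B) and
-- X ∪ C ∪ A ∖ {a} (a ∈ A other than the first point).  If two e-sets had equal
-- overlaps with all landmarks but met A in different numbers of points, the one
-- meeting A less would contain X, C and B, which is too many points; with equal
-- |A|-parts, the landmarks read off X, C, B and A pointwise.  This proves the
-- bound for all e ≥ 2, the theorem being the case e ≥ 3.

open import Defs
open import Level using (Level)
open import Relation.Binary.Definitions using (tri<; tri≈; tri>)
open import Data.Nat using (ℕ; zero; suc; _+_; _*_; _∸_; _≤_; _<_; z≤n; s≤s)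
open import Data.Nat.Properties
open import Data.Bool using (Bool; true; false)
open import Data.Vec using ([]; _∷_; _++_; splitAt)
open import Data.Vec.Properties using (zipWith-++)
open import Data.Fin using (Fin)
import Data.Fin as Fin
open import Data.Fin.Subset using (Subset; ∣_∣; _∩_; ⊤; ⊥; ⁅_⁆; ∁)
open import Data.Fin.Subset.Properties using (∣⊤∣≡n; ∣⊥∣≡0; ∣⁅x⁆∣≡1; ∣p∩q∣≤∣p∣; ∣p∩q∣≤∣q∣; ∩-comm; ∩-idem; ∩-identityʳ; ∩-zeroʳ; ∣∁p∣≡n∸∣p∣; ∣p∣≤n)
open import Data.List using (List; length; map; allFin; _∷_)
import Data.List as List
open import Data.List.Properties using (length-++; length-map; length-tabulate)
open import Data.List.Relation.Unary.Any using (here; there)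
open import Data.List.Membership.Propositional using (_∈_)
open import Data.List.Membership.Propositional.Properties using (∈-++⁺ˡ; ∈-++⁺ʳ; ∈-map⁺; ∈-allFin)
open import Data.Product using (Σ; _×_; _,_; proj₁; proj₂)
open import Data.Empty using (⊥-elim)
open import Relation.Nullary using (¬_)
open import Relation.Binary.PropositionalEquality
open import Function using (id)
open import Function.Bundles using (Equivalence)

∣++∣ : ∀ {m n} (p : Subset m) (q : Subset n) → ∣ p ++ q ∣ ≡ ∣ p ∣ + ∣ q ∣
∣++∣ [] q = refl
∣++∣ (true ∷ p) q = cong suc (∣++∣ p q)
∣++∣ (false ∷ p) q = ∣++∣ p q

∣++∩++∣ : ∀ {m n} (p p' : Subset m) (q q' : Subset n) →
  ∣ (p ++ q) ∩ (p' ++ q') ∣ ≡ ∣ p ∩ p' ∣ + ∣ q ∩ q' ∣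
∣++∩++∣ p p' q q' = trans (cong ∣_∣ (zipWith-++ _ p q p' q')) (∣++∣ (p ∩ p') (q ∩ q'))

∣p∩⊤∣≡∣p∣ : ∀ {m} (p : Subset m) → ∣ p ∩ ⊤ ∣ ≡ ∣ p ∣
∣p∩⊤∣≡∣p∣ p = cong ∣_∣ (∩-identityʳ p)

∣p∩⊥∣≡0 : ∀ {m} (p : Subset m) → ∣ p ∩ ⊥ ∣ ≡ 0
∣p∩⊥∣≡0 {m} p = trans (cong ∣_∣ (∩-zeroʳ p)) (∣⊥∣≡0 m)

∣p∩∁q∣+∣p∩q∣≡∣p∣ : ∀ {m} (p q : Subset m) → ∣ p ∩ ∁ q ∣ + ∣ p ∩ q ∣ ≡ ∣ p ∣
∣p∩∁q∣+∣p∩q∣≡∣p∣ [] [] = refl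
∣p∩∁q∣+∣p∩q∣≡∣p∣ (true ∷ p) (true ∷ q) = trans (+-suc _ _) (cong suc (∣p∩∁q∣+∣p∩q∣≡∣p∣ p q))
∣p∩∁q∣+∣p∩q∣≡∣p∣ (true ∷ p) (false ∷ q) = cong suc (∣p∩∁q∣+∣p∩q∣≡∣p∣ p q)
∣p∩∁q∣+∣p∩q∣≡∣p∣ (false ∷ p) (true ∷ q) = ∣p∩∁q∣+∣p∩q∣≡∣p∣ p q
∣p∩∁q∣+∣p∩q∣≡∣p∣ (false ∷ p) (false ∷ q) = ∣p∩∁q∣+∣p∩q∣≡∣p∣ p q

∣∁p∣+∣p∣≡n : ∀ {m} (p : Subset m) → ∣ ∁ p ∣ + ∣ p ∣ ≡ m
∣∁p∣+∣p∣≡n p = trans (cong (_+ ∣ p ∣) (∣∁p∣≡n∸∣p∣ p)) (m∸n+n≡m (∣p∣≤n p))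

full-overlap⇒≡ : ∀ {m} (p s : Subset m) → ∣ p ∩ s ∣ ≡ ∣ p ∣ → ∣ p ∩ s ∣ ≡ ∣ s ∣ → p ≡ s
full-overlap⇒≡ [] [] _ _ = refl
full-overlap⇒≡ (true ∷ p) (true ∷ s) h h' =
  cong (true ∷_) (full-overlap⇒≡ p s (suc-injective h) (suc-injective h'))
full-overlap⇒≡ (false ∷ p) (false ∷ s) h h' = cong (false ∷_) (full-overlap⇒≡ p s h h')
full-overlap⇒≡ (true ∷ p) (false ∷ s) h _ = ⊥-elim (<⇒≢ (s≤s (∣p∩q∣≤∣p∣ p s)) h)
full-overlap⇒≡ (false ∷ p) (true ∷ s) _ h' = ⊥-elim (<⇒≢ (s≤s (∣p∩q∣≤∣q∣ p s)) h')

head-determined : ∀ {m} (y y' : Bool) (p : Subset m) → ∣ y ∷ p ∣ ≡ ∣ y' ∷ p ∣ → y ≡ y'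
head-determined true true p _ = refl
head-determined false false p _ = refl
head-determined true false p h = ⊥-elim (1+n≢n h)
head-determined false true p h = ⊥-elim (1+n≢n (sym h))

size-determines-Subset1 : (x x' : Subset 1) → ∣ x ∣ ≡ ∣ x' ∣ → x ≡ x'
size-determines-Subset1 (y ∷ []) (y' ∷ []) h = cong (_∷ []) (head-determined y y' [] h)

∣y∷p∩⁅0⁆∣ : ∀ {m} (y : Bool) (p : Subset m) → ∣ (y ∷ p) ∩ ⁅ Fin.zero ⁆ ∣ ≡ ∣ y ∷ [] ∣
∣y∷p∩⁅0⁆∣ true p = cong suc (∣p∩⊥∣≡0 p)
∣y∷p∩⁅0⁆∣ false p = ∣p∩⊥∣≡0 p

∣y∷p∩⁅suc⁆∣ : ∀ {m} (y : Bool) (p : Subset m) (i : Fin m) →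
  ∣ (y ∷ p) ∩ ⁅ Fin.suc i ⁆ ∣ ≡ ∣ p ∩ ⁅ i ⁆ ∣
∣y∷p∩⁅suc⁆∣ true p i = refl
∣y∷p∩⁅suc⁆∣ false p i = refl

singletons-determine : ∀ {m} (p p' : Subset m) →
  (∀ i → ∣ p ∩ ⁅ i ⁆ ∣ ≡ ∣ p' ∩ ⁅ i ⁆ ∣) → p ≡ p'
singletons-determine [] [] _ = refl
singletons-determine (y ∷ p) (y' ∷ p') h = cong₂ _∷_ heads tails
  where
  tails : p ≡ p'
  tails = singletons-determine p p' λ i →
    trans (sym (∣y∷p∩⁅suc⁆∣ y p i)) (trans (h (Fin.suc i)) (∣y∷p∩⁅suc⁆∣ y' p' i))
  heads : y ≡ y'
  heads = head-determined y y' [] (trans (sym (∣y∷p∩⁅0⁆∣ y p)) (trans (h Fin.zero) (∣y∷p∩⁅0⁆∣ y' p')))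

meets-all-singletons⇒full : ∀ {m} (p : Subset m) → (∀ i → 1 ≤ ∣ p ∩ ⁅ i ⁆ ∣) → ∣ p ∣ ≡ m
meets-all-singletons⇒full [] _ = refl
meets-all-singletons⇒full (true ∷ p) h = cong suc (meets-all-singletons⇒full p (λ i → h (Fin.suc i)))
meets-all-singletons⇒full (false ∷ p) h = ⊥-elim (<⇒≱ (h Fin.zero) (≤-reflexive (∣p∩⊥∣≡0 p)))

∣p∩co-singleton∣ : ∀ {m} (y : Bool) (p : Subset m) (i : Fin m) →
  ∣ (y ∷ p) ∩ (true ∷ ∁ ⁅ i ⁆) ∣ + ∣ p ∩ ⁅ i ⁆ ∣ ≡ ∣ y ∷ p ∣
∣p∩co-singleton∣ true p i = cong suc (∣p∩∁q∣+∣p∩q∣≡∣p∣ p ⁅ i ⁆)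
∣p∩co-singleton∣ false p i = ∣p∩∁q∣+∣p∩q∣≡∣p∣ p ⁅ i ⁆

co-singletons-determine : ∀ {m} (p p' : Subset (suc m)) → ∣ p ∣ ≡ ∣ p' ∣ →
  (∀ i → ∣ p ∩ (true ∷ ∁ ⁅ i ⁆) ∣ ≡ ∣ p' ∩ (true ∷ ∁ ⁅ i ⁆) ∣) → p ≡ p'
co-singletons-determine (y ∷ p) (y' ∷ p') size co = cong₂ _∷_ heads tails
  where
  tails : p ≡ p'
  tails = singletons-determine p p' λ i → +-cancelˡ-≡ _ _ _ (begin
    ∣ (y ∷ p) ∩ (true ∷ ∁ ⁅ i ⁆) ∣ + ∣ p ∩ ⁅ i ⁆ ∣     ≡⟨ ∣p∩co-singleton∣ y p i ⟩
    ∣ y ∷ p ∣                                        ≡⟨ size ⟩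
    ∣ y' ∷ p' ∣                                      ≡⟨ sym (∣p∩co-singleton∣ y' p' i) ⟩
    ∣ (y' ∷ p') ∩ (true ∷ ∁ ⁅ i ⁆) ∣ + ∣ p' ∩ ⁅ i ⁆ ∣  ≡⟨ cong (_+ _) (sym (co i)) ⟩
    ∣ (y ∷ p) ∩ (true ∷ ∁ ⁅ i ⁆) ∣ + ∣ p' ∩ ⁅ i ⁆ ∣    ∎)
    where open ≡-Reasoning
  heads : y ≡ y'
  heads = head-determined y y' p (trans size (cong (λ t → ∣ y' ∷ t ∣) (sym tails)))

module _ {a r : Level} {V : Set a} (Adj : V → V → Set r) where

  Dist-unique : ∀ {u v k k'} → Dist Adj u v k → Dist Adj u v k' → k ≡ k'
  Dist-unique {k = k} {k'} (walk , minimal) (walk' , minimal') with <-cmp k k'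
  ... | tri< k<k' _ _ = ⊥-elim (minimal' k k<k' walk)
  ... | tri≈ _ k≡k' _ = k≡k'
  ... | tri> _ _ k>k' = ⊥-elim (minimal k' k>k' walk')

  resolving-via-formula : ∀ {ℓ} (_≈_ : V → V → Set ℓ) (δ : V → V → ℕ) →
    (∀ u s → Dist Adj u s (δ u s)) → (S : List V) →
    (∀ u v → (∀ s → s ∈ S → δ u s ≡ δ v s) → u ≈ v) → Resolving Adj _≈_ S
  resolving-via-formula _≈_ δ dist S separates u v sameDist =
    separates u v λ s s∈S →
      Dist-unique (Equivalence.to (sameDist s s∈S (δ u s)) (dist u s)) (dist v s)

-- Replacing p by p' raises the overlap with s by at most |p| − |p ∩ p'|, the
-- number of points of p that p' does not keep.
overlap-exchange : ∀ {m} (p p' s : Subset m) → ∣ p ∩ s ∣ + ∣ p ∩ p' ∣ ≤ ∣ p' ∩ s ∣ + ∣ p ∣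
overlap-exchange [] [] [] = z≤n
overlap-exchange (true ∷ p) (true ∷ p') (true ∷ s)
  rewrite +-suc ∣ p ∩ s ∣ ∣ p ∩ p' ∣ | +-suc ∣ p' ∩ s ∣ ∣ p ∣ = s≤s (s≤s (overlap-exchange p p' s))
overlap-exchange (true ∷ p) (true ∷ p') (false ∷ s)
  rewrite +-suc ∣ p ∩ s ∣ ∣ p ∩ p' ∣ | +-suc ∣ p' ∩ s ∣ ∣ p ∣ = s≤s (overlap-exchange p p' s)
overlap-exchange (true ∷ p) (false ∷ p') (true ∷ s)
  rewrite +-suc ∣ p' ∩ s ∣ ∣ p ∣ = s≤s (overlap-exchange p p' s)
overlap-exchange (true ∷ p) (false ∷ p') (false ∷ s)
  rewrite +-suc ∣ p' ∩ s ∣ ∣ p ∣ = m≤n⇒m≤1+n (overlap-exchange p p' s)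
overlap-exchange (false ∷ p) (true ∷ p') (true ∷ s) = m≤n⇒m≤1+n (overlap-exchange p p' s)
overlap-exchange (false ∷ p) (true ∷ p') (false ∷ s) = overlap-exchange p p' s
overlap-exchange (false ∷ p) (false ∷ p') (true ∷ s) = overlap-exchange p p' s
overlap-exchange (false ∷ p) (false ∷ p') (false ∷ s) = overlap-exchange p p' s

add-point-of : ∀ {m} (p s : Subset m) → ∣ p ∩ s ∣ < ∣ s ∣ →
  Σ (Subset m) λ q → ∣ q ∣ ≡ suc ∣ p ∣ × ∣ p ∩ q ∣ ≡ ∣ p ∣ × ∣ q ∩ s ∣ ≡ suc ∣ p ∩ s ∣
add-point-of (false ∷ p) (true ∷ s) _ = true ∷ p , refl , cong ∣_∣ (∩-idem p) , refl
add-point-of (false ∷ p) (false ∷ s) lt with add-point-of p s lt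
... | q , h₁ , h₂ , h₃ = false ∷ q , h₁ , h₂ , h₃
add-point-of (true ∷ p) (true ∷ s) (s≤s lt) with add-point-of p s lt
... | q , h₁ , h₂ , h₃ = true ∷ q , cong suc h₁ , cong suc h₂ , cong suc h₃
add-point-of (true ∷ p) (false ∷ s) lt with add-point-of p s lt
... | q , h₁ , h₂ , h₃ = true ∷ q , cong suc h₁ , cong suc h₂ , h₃

remove-point-outside : ∀ {m} (p s : Subset m) → ∣ p ∩ s ∣ < ∣ p ∣ →
  Σ (Subset m) λ q → suc ∣ q ∣ ≡ ∣ p ∣ × ∣ p ∩ q ∣ ≡ ∣ q ∣ × ∣ q ∩ s ∣ ≡ ∣ p ∩ s ∣
remove-point-outside (true ∷ p) (false ∷ s) _ = false ∷ p , refl , cong ∣_∣ (∩-idem p) , refl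
remove-point-outside (false ∷ p) (y ∷ s) lt with remove-point-outside p s lt
... | q , h₁ , h₂ , h₃ = false ∷ q , h₁ , h₂ , h₃
remove-point-outside (true ∷ p) (true ∷ s) (s≤s lt) with remove-point-outside p s lt
... | q , h₁ , h₂ , h₃ = true ∷ q , cong suc h₁ , cong suc h₂ , cong suc h₃

exchange-towards : ∀ {m} (p s : Subset m) → ∣ p ∩ s ∣ < ∣ p ∣ → ∣ p ∩ s ∣ < ∣ s ∣ →
  Σ (Subset m) λ q → ∣ q ∣ ≡ ∣ p ∣ × suc ∣ p ∩ q ∣ ≡ ∣ p ∣ × ∣ q ∩ s ∣ ≡ suc ∣ p ∩ s ∣
exchange-towards (true ∷ p) (true ∷ s) (s≤s lt) (s≤s lt') with exchange-towards p s lt lt'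
... | q , h₁ , h₂ , h₃ = true ∷ q , cong suc h₁ , cong suc h₂ , cong suc h₃
exchange-towards (false ∷ p) (false ∷ s) lt lt' with exchange-towards p s lt lt'
... | q , h₁ , h₂ , h₃ = false ∷ q , h₁ , h₂ , h₃
exchange-towards (true ∷ p) (false ∷ s) _ lt' with add-point-of p s lt'
... | q , h₁ , h₂ , h₃ = false ∷ q , h₁ , cong suc h₂ , h₃
exchange-towards (false ∷ p) (true ∷ s) lt _ with remove-point-outside p s lt
... | q , h₁ , h₂ , h₃ = true ∷ q , h₁ , trans (cong suc h₂) h₁ , cong suc h₃

common : ∀ {n e} → JVertex n e → JVertex n e → ℕ
common P Q = ∣ proj₁ P ∩ proj₁ Q ∣

module Johnson (n e : ℕ) where

  vertex-≡ : {P Q : JVertex n e} → P ≈J Q → P ≡ Q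
  vertex-≡ {p , _} {.p , _} refl = cong (p ,_) (≡-irrelevant _ _)

  common≤e : (P S : JVertex n e) → common P S ≤ e
  common≤e (p , |p|≡e) (s , _) = subst (∣ p ∩ s ∣ ≤_) |p|≡e (∣p∩q∣≤∣p∣ p s)

  edge-overlap : ∀ {P W} s → JAdj n e P W → ∣ proj₁ W ∩ s ∣ ≤ suc ∣ proj₁ P ∩ s ∣
  edge-overlap {p , _} {w , |w|≡e} s adj = cancel-pred e
    (subst₂ (λ x y → ∣ w ∩ s ∣ + x ≤ ∣ p ∩ s ∣ + y)
      (trans (cong ∣_∣ (∩-comm w p)) adj) |w|≡e (overlap-exchange w p s))
    where
    cancel-pred : ∀ e {x y} → x + (e ∸ 1) ≤ y + e → x ≤ suc y
    cancel-pred zero {x} {y} le =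
      m≤n⇒m≤1+n (subst₂ _≤_ (+-identityʳ x) (+-identityʳ y) le)
    cancel-pred (suc e) {x} {y} le = +-cancelʳ-≤ e x (suc y) (subst (x + e ≤_) (+-suc y e) le)

  walk-overlap : ∀ {P Q j} s → Walk (JAdj n e) P Q j → ∣ proj₁ Q ∩ s ∣ ≤ ∣ proj₁ P ∩ s ∣ + j
  walk-overlap {P} s here = m≤m+n (∣ proj₁ P ∩ s ∣) 0
  walk-overlap {P} {Q} {suc j} s (step {w = W} adj walk) = begin
    ∣ proj₁ Q ∩ s ∣            ≤⟨ walk-overlap s walk ⟩
    ∣ proj₁ W ∩ s ∣ + j        ≤⟨ +-monoˡ-≤ j (edge-overlap {P} {W} s adj) ⟩
    suc ∣ proj₁ P ∩ s ∣ + j    ≡⟨ sym (+-suc _ j) ⟩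
    ∣ proj₁ P ∩ s ∣ + suc j    ∎
    where open ≤-Reasoning

  walk-towards : ∀ (S : JVertex n e) m P → common P S + m ≡ e → Walk (JAdj n e) P S m
  walk-towards S@(s , |s|≡e) zero P@(p , |p|≡e) full =
    subst (λ Q → Walk (JAdj n e) P Q 0) (vertex-≡ P≈S) here
    where
    overlap≡e : ∣ p ∩ s ∣ ≡ e
    overlap≡e = trans (sym (+-identityʳ _)) full
    P≈S : p ≡ s
    P≈S = full-overlap⇒≡ p s (trans overlap≡e (sym |p|≡e)) (trans overlap≡e (sym |s|≡e))
  walk-towards S@(s , |s|≡e) (suc m) P@(p , |p|≡e) full with
    exchange-towards p s
      (subst (∣ p ∩ s ∣ <_) (sym |p|≡e) overlap<e) (subst (∣ p ∩ s ∣ <_) (sym |s|≡e) overlap<e)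
    where
    overlap<e : ∣ p ∩ s ∣ < e
    overlap<e = subst (∣ p ∩ s ∣ <_) full (subst (∣ p ∩ s ∣ <_) (sym (+-suc _ m)) (s≤s (m≤m+n _ m)))
  ... | q , |q|≡|p| , adj , closer =
    step (cong (_∸ 1) (trans adj |p|≡e))
      (walk-towards S m (q , trans |q|≡|p| |p|≡e)
        (trans (cong (_+ m) closer) (trans (sym (+-suc _ m)) full)))

  distance : ∀ P S → Dist (JAdj n e) P S (e ∸ common P S)
  distance P S = walk-towards S _ P (m+[n∸m]≡n (common≤e P S)) , no-shorter
    where
    no-shorter : ∀ j → j < e ∸ common P S → ¬ Walk (JAdj n e) P S j
    no-shorter j j<d walk = <⇒≱ j<d (m≤n+o⇒m∸n≤o e (common P S)
      (subst (_≤ common P S + j) (trans (cong ∣_∣ (∩-idem (proj₁ S))) (proj₂ S))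
        (walk-overlap (proj₁ S) walk)))

  resolving-via-overlaps : (S : List (JVertex n e)) →
    (∀ P Q → (∀ s → s ∈ S → common P s ≡ common Q s) → P ≈J Q) →
    Resolving (JAdj n e) _≈J_ S
  resolving-via-overlaps S separates =
    resolving-via-formula (JAdj n e) _≈J_ (λ P s → e ∸ common P s) (λ P s → distance P s) S
      λ P Q sameDist → separates P Q λ s s∈S →
        ∸-cancelˡ-≡ (common≤e P s) (common≤e Q s) (sameDist s s∈S)

compensates : ∀ {X α X' α'} → α < α' → X + α ≡ X' + α' → 1 ≤ X
compensates {zero} {α} {X'} {α'} α<α' same = ⊥-elim (<⇒≱ α<α' (subst (α' ≤_) (sym same) (m≤n+m α' X')))
compensates {suc X} _ _ = s≤s z≤n

module Construction (m : ℕ) where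

  e : ℕ
  e = 2 + m

  N : ℕ
  N = 2 * e + 1

  -- The size of B is written e + 0, the way 2 * e unfolds, so that a layout has
  -- size N by computation.
  layout : Subset 1 → Subset (suc m) → Subset (e + 0) → Subset 1 → Subset N
  layout x a b c = x ++ ((a ++ b) ++ c)

  ∣layout∣ : ∀ x a b c → ∣ layout x a b c ∣ ≡ ∣ x ∣ + ((∣ a ∣ + ∣ b ∣) + ∣ c ∣)
  ∣layout∣ x a b c = trans (∣++∣ x _)
    (cong (∣ x ∣ +_) (trans (∣++∣ (a ++ b) c) (cong (_+ ∣ c ∣) (∣++∣ a b))))

  ∣layout∩layout∣ : ∀ x a b c x' a' b' c' → ∣ layout x a b c ∩ layout x' a' b' c' ∣ ≡
    ∣ x ∩ x' ∣ + ((∣ a ∩ a' ∣ + ∣ b ∩ b' ∣) + ∣ c ∩ c' ∣)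
  ∣layout∩layout∣ x a b c x' a' b' c' = trans (∣++∩++∣ x x' _ _)
    (cong (∣ x ∩ x' ∣ +_) (trans (∣++∩++∣ (a ++ b) (a' ++ b') c c')
      (cong (_+ ∣ c ∩ c' ∣) (∣++∩++∣ a a' b b'))))

  landmark : ∀ x a b c → ∣ x ∣ + ((∣ a ∣ + ∣ b ∣) + ∣ c ∣) ≡ e → JVertex N e
  landmark x a b c size = layout x a b c , trans (∣layout∣ x a b c) size

  X∪A A∪C : JVertex N e
  X∪A = landmark ⊤ ⊤ ⊥ ⊥ (cong suc (begin
    (∣ ⊤ {suc m} ∣ + ∣ ⊥ {e + 0} ∣) + 0  ≡⟨ +-identityʳ _ ⟩
    ∣ ⊤ {suc m} ∣ + ∣ ⊥ {e + 0} ∣        ≡⟨ cong₂ _+_ (∣⊤∣≡n (suc m)) (∣⊥∣≡0 (e + 0)) ⟩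
    suc m + 0                          ≡⟨ +-identityʳ (suc m) ⟩
    suc m                              ∎))
    where open ≡-Reasoning
  A∪C = landmark ⊥ ⊤ ⊥ ⊤ (begin
    (∣ ⊤ {suc m} ∣ + ∣ ⊥ {e + 0} ∣) + 1  ≡⟨ cong (_+ 1) (cong₂ _+_ (∣⊤∣≡n (suc m)) (∣⊥∣≡0 (e + 0))) ⟩
    (suc m + 0) + 1                    ≡⟨ cong (_+ 1) (+-identityʳ (suc m)) ⟩
    suc m + 1                          ≡⟨ +-comm (suc m) 1 ⟩
    e                                  ∎)
    where open ≡-Reasoning

  A∪b : Fin (e + 0) → JVertex N e
  A∪b i = landmark ⊥ ⊤ ⁅ i ⁆ ⊥ (begin
    (∣ ⊤ {suc m} ∣ + ∣ ⁅ i ⁆ ∣) + 0  ≡⟨ +-identityʳ _ ⟩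
    ∣ ⊤ {suc m} ∣ + ∣ ⁅ i ⁆ ∣        ≡⟨ cong₂ _+_ (∣⊤∣≡n (suc m)) (∣⁅x⁆∣≡1 i) ⟩
    suc m + 1                      ≡⟨ +-comm (suc m) 1 ⟩
    e                              ∎)
    where open ≡-Reasoning

  X∪C∪A-a : Fin m → JVertex N e
  X∪C∪A-a i = landmark ⊤ (true ∷ ∁ ⁅ i ⁆) ⊥ ⊤ (cong (λ k → suc (suc k)) (begin
    (∣ ∁ ⁅ i ⁆ ∣ + ∣ ⊥ {e + 0} ∣) + 1  ≡⟨ cong (λ k → (∣ ∁ ⁅ i ⁆ ∣ + k) + 1) (∣⊥∣≡0 (e + 0)) ⟩
    (∣ ∁ ⁅ i ⁆ ∣ + 0) + 1            ≡⟨ cong₂ _+_ (+-identityʳ _) (sym (∣⁅x⁆∣≡1 i)) ⟩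
    ∣ ∁ ⁅ i ⁆ ∣ + ∣ ⁅ i ⁆ ∣            ≡⟨ ∣∁p∣+∣p∣≡n ⁅ i ⁆ ⟩
    m                              ∎))
    where open ≡-Reasoning

  reads-X∪A : ∀ x a b c → ∣ layout x a b c ∩ proj₁ X∪A ∣ ≡ ∣ x ∣ + ∣ a ∣
  reads-X∪A x a b c rewrite ∣layout∩layout∣ x a b c ⊤ ⊤ ⊥ ⊥
    | ∣p∩⊤∣≡∣p∣ x | ∣p∩⊤∣≡∣p∣ a | ∣p∩⊥∣≡0 b | ∣p∩⊥∣≡0 c =
    cong (∣ x ∣ +_) (trans (+-identityʳ _) (+-identityʳ _))

  reads-A∪C : ∀ x a b c → ∣ layout x a b c ∩ proj₁ A∪C ∣ ≡ ∣ a ∣ + ∣ c ∣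
  reads-A∪C x a b c rewrite ∣layout∩layout∣ x a b c ⊥ ⊤ ⊥ ⊤
    | ∣p∩⊥∣≡0 x | ∣p∩⊤∣≡∣p∣ a | ∣p∩⊥∣≡0 b | ∣p∩⊤∣≡∣p∣ c =
    cong (_+ ∣ c ∣) (+-identityʳ _)

  reads-A∪b : ∀ x a b c i → ∣ layout x a b c ∩ proj₁ (A∪b i) ∣ ≡ ∣ a ∣ + ∣ b ∩ ⁅ i ⁆ ∣
  reads-A∪b x a b c i rewrite ∣layout∩layout∣ x a b c ⊥ ⊤ ⁅ i ⁆ ⊥
    | ∣p∩⊥∣≡0 x | ∣p∩⊤∣≡∣p∣ a | ∣p∩⊥∣≡0 c =
    +-identityʳ _

  reads-X∪C∪A-a : ∀ x a b c i → ∣ layout x a b c ∩ proj₁ (X∪C∪A-a i) ∣ ≡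
    ∣ x ∣ + (∣ a ∩ (true ∷ ∁ ⁅ i ⁆) ∣ + ∣ c ∣)
  reads-X∪C∪A-a x a b c i rewrite ∣layout∩layout∣ x a b c ⊤ (true ∷ ∁ ⁅ i ⁆) ⊥ ⊤
    | ∣p∩⊤∣≡∣p∣ x | ∣p∩⊥∣≡0 b | ∣p∩⊤∣≡∣p∣ c =
    cong (λ k → ∣ x ∣ + (k + ∣ c ∣)) (+-identityʳ _)

  record Agree (x : Subset 1) (a : Subset (suc m)) (b : Subset (e + 0)) (c : Subset 1)
               (x' : Subset 1) (a' : Subset (suc m)) (b' : Subset (e + 0)) (c' : Subset 1) : Set where
    field
      on-X∪A : ∣ x ∣ + ∣ a ∣ ≡ ∣ x' ∣ + ∣ a' ∣
      on-A∪C : ∣ a ∣ + ∣ c ∣ ≡ ∣ a' ∣ + ∣ c' ∣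
      on-A∪b : ∀ i → ∣ a ∣ + ∣ b ∩ ⁅ i ⁆ ∣ ≡ ∣ a' ∣ + ∣ b' ∩ ⁅ i ⁆ ∣
      on-X∪C∪A-a : ∀ i → ∣ x ∣ + (∣ a ∩ (true ∷ ∁ ⁅ i ⁆) ∣ + ∣ c ∣) ≡
                         ∣ x' ∣ + (∣ a' ∩ (true ∷ ∁ ⁅ i ⁆) ∣ + ∣ c' ∣)

  Agree-sym : ∀ {x a b c x' a' b' c'} → Agree x a b c x' a' b' c' → Agree x' a' b' c' x a b c
  Agree-sym agree = record
    { on-X∪A = sym on-X∪A ; on-A∪C = sym on-A∪C
    ; on-A∪b = λ i → sym (on-A∪b i) ; on-X∪C∪A-a = λ i → sym (on-X∪C∪A-a i) }
    where open Agree agree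

  -- A vertex cannot meet A in fewer points than an agreeing one: it would have to
  -- contain X, C and all of B, i.e. at least e + 2 points.
  A-not-smaller : ∀ {x a b c x' a' b' c'} → Agree x a b c x' a' b' c' →
    ∣ x ∣ + ((∣ a ∣ + ∣ b ∣) + ∣ c ∣) ≡ e → ¬ ∣ a ∣ < ∣ a' ∣
  A-not-smaller {x} {a} {b} {c} {a' = a'} agree size a<a' = 1+n≰n (begin-strict
    e                            ≤⟨ m≤m+n e 0 ⟩
    e + 0                        ≡⟨ sym B-full ⟩
    ∣ b ∣                        ≤⟨ m≤n+m ∣ b ∣ ∣ a ∣ ⟩
    ∣ a ∣ + ∣ b ∣                <⟨ m<m+n _ (s≤s z≤n) ⟩
    (∣ a ∣ + ∣ b ∣) + 1          ≤⟨ +-monoʳ-≤ (∣ a ∣ + ∣ b ∣) C-met ⟩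
    (∣ a ∣ + ∣ b ∣) + ∣ c ∣      <⟨ +-monoˡ-≤ _ X-met ⟩
    ∣ x ∣ + ((∣ a ∣ + ∣ b ∣) + ∣ c ∣) ≡⟨ size ⟩
    e                            ∎)
    where
    open Agree agree
    open ≤-Reasoning
    X-met : 1 ≤ ∣ x ∣
    X-met = compensates a<a' on-X∪A
    C-met : 1 ≤ ∣ c ∣
    C-met = compensates a<a' (trans (+-comm ∣ c ∣ ∣ a ∣) (trans on-A∪C (+-comm ∣ a' ∣ _)))
    B-full : ∣ b ∣ ≡ e + 0
    B-full = meets-all-singletons⇒full b λ i →
      compensates a<a' (trans (+-comm _ ∣ a ∣) (trans (on-A∪b i) (+-comm ∣ a' ∣ _)))

  layout-determined : ∀ {x a b c x' a' b' c'} → Agree x a b c x' a' b' c' →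
    ∣ x ∣ + ((∣ a ∣ + ∣ b ∣) + ∣ c ∣) ≡ e → ∣ x' ∣ + ((∣ a' ∣ + ∣ b' ∣) + ∣ c' ∣) ≡ e →
    layout x a b c ≡ layout x' a' b' c'
  layout-determined {x} {a} {b} {c} {x'} {a'} {b'} {c'} agree size size' =
    cong₂ _++_ x≡x' (cong₂ _++_ (cong₂ _++_ a≡a' b≡b') c≡c')
    where
    open Agree agree
    ∣a∣≡∣a'∣ : ∣ a ∣ ≡ ∣ a' ∣
    ∣a∣≡∣a'∣ = ≤-antisym (≮⇒≥ (A-not-smaller (Agree-sym agree) size'))
                         (≮⇒≥ (A-not-smaller agree size))
    ∣x∣≡∣x'∣ : ∣ x ∣ ≡ ∣ x' ∣
    ∣x∣≡∣x'∣ = +-cancelʳ-≡ ∣ a ∣ _ _ (trans on-X∪A (cong (∣ x' ∣ +_) (sym ∣a∣≡∣a'∣)))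
    ∣c∣≡∣c'∣ : ∣ c ∣ ≡ ∣ c' ∣
    ∣c∣≡∣c'∣ = +-cancelˡ-≡ ∣ a ∣ _ _ (trans on-A∪C (cong (_+ ∣ c' ∣) (sym ∣a∣≡∣a'∣)))
    x≡x' : x ≡ x'
    x≡x' = size-determines-Subset1 x x' ∣x∣≡∣x'∣
    c≡c' : c ≡ c'
    c≡c' = size-determines-Subset1 c c' ∣c∣≡∣c'∣
    b≡b' : b ≡ b'
    b≡b' = singletons-determine b b' λ i →
      +-cancelˡ-≡ ∣ a ∣ _ _ (trans (on-A∪b i) (cong (_+ _) (sym ∣a∣≡∣a'∣)))
    a≡a' : a ≡ a'
    a≡a' = co-singletons-determine a a' ∣a∣≡∣a'∣ λ i →
      +-cancelʳ-≡ ∣ c ∣ _ _ (+-cancelˡ-≡ ∣ x ∣ _ _ (trans (on-X∪C∪A-a i)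
        (cong₂ (λ X C → X + (_ + C)) (sym ∣x∣≡∣x'∣) (sym ∣c∣≡∣c'∣))))

  data Blocks : Subset N → Set where
    blocks : ∀ x a b c → Blocks (layout x a b c)

  split-blocks : ∀ p → Blocks p
  split-blocks p with splitAt 1 p
  ... | x , rest , refl with splitAt (suc m + (e + 0)) rest
  ... | ab , c , refl with splitAt (suc m) ab
  ... | a , b , refl = blocks x a b c

  landmarks : List (JVertex N e)
  landmarks = X∪A ∷ A∪C ∷ map A∪b (allFin (e + 0)) List.++ map X∪C∪A-a (allFin m)

  length-landmarks : length landmarks ≡ 2 * e
  length-landmarks = cong (λ k → suc (suc k)) (begin
    length (map A∪b (allFin (e + 0)) List.++ map X∪C∪A-a (allFin m))  ≡⟨ length-++ (map A∪b (allFin (e + 0))) ⟩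
    length (map A∪b (allFin (e + 0))) + length (map X∪C∪A-a (allFin m)) ≡⟨ cong₂ _+_ (length-mapAllFin A∪b) (length-mapAllFin X∪C∪A-a) ⟩
    (e + 0) + m                                                      ≡⟨ +-comm (e + 0) m ⟩
    m + (e + 0)                                                      ∎)
    where
    open ≡-Reasoning
    length-mapAllFin : ∀ {k} (f : Fin k → JVertex N e) → length (map f (allFin k)) ≡ k
    length-mapAllFin f = trans (length-map f (allFin _)) (length-tabulate id)

  landmarks-separate : ∀ P Q → (∀ s → s ∈ landmarks → common P s ≡ common Q s) → P ≈J Q
  landmarks-separate (p , |p|≡e) (q , |q|≡e) same with split-blocks p | split-blocks q
  ... | blocks x a b c | blocks x' a' b' c' = layout-determined agree
    (trans (sym (∣layout∣ x a b c)) |p|≡e) (trans (sym (∣layout∣ x' a' b' c')) |q|≡e)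
    where
    agree : Agree x a b c x' a' b' c'
    agree = record
      { on-X∪A = trans (sym (reads-X∪A x a b c)) (trans (same X∪A (here refl)) (reads-X∪A x' a' b' c'))
      ; on-A∪C = trans (sym (reads-A∪C x a b c)) (trans (same A∪C (there (here refl))) (reads-A∪C x' a' b' c'))
      ; on-A∪b = λ i → trans (sym (reads-A∪b x a b c i))
          (trans (same (A∪b i) (there (there (∈-++⁺ˡ (∈-map⁺ A∪b (∈-allFin i)))))) (reads-A∪b x' a' b' c' i))
      ; on-X∪C∪A-a = λ i → trans (sym (reads-X∪C∪A-a x a b c i))
          (trans (same (X∪C∪A-a i) (there (there (∈-++⁺ʳ (map A∪b (allFin (e + 0))) (∈-map⁺ X∪C∪A-a (∈-allFin i))))))
            (reads-X∪C∪A-a x' a' b' c' i))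
      }

  metric-dimension≤2e : MetricDimension≤ (JAdj N e) _≈J_ (2 * e)
  metric-dimension≤2e = landmarks , ≤-reflexive length-landmarks ,
    Johnson.resolving-via-overlaps N e landmarks landmarks-separate

theorem2p2 : (e : ℕ) → 3 ≤ e →
    MetricDimension≤ (JAdj (2 * e + 1) e) _≈J_ (2 * e)
theorem2p2 zero ()
theorem2p2 (suc zero) (s≤s ())
theorem2p2 (suc (suc m)) _ = Construction.metric-dimension≤2e m
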